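{- Let $w,c\ge 0$ be integers, let $G$ be a graph, and let $(W_1,\ldots,W_n)$ be a $w$-colourable grading of $G$ with $\chi(G)>w+2c$. Then there exist subsets $X,Y$ of $V(G)$ such that: $G[X]$ and $G[Y]$ are both connected; every vertex in $Y$ is earlier than every vertex in $X$; some vertex in $X$ has a neighbour in $Y$; and $\chi(X)>c$ and $\chi(Y)>c$.
   Context: Graphs are finite with no loops or parallel edges. For $X\subseteq V(G)$, $G[X]$ is the induced subgraph on $X$ and $\chi(X)$ means $\chi(G[X])$. A grading of $G$ is a sequence $(W_1,\ldots,W_n)$ of pairwise disjoint subsets of $V(G)$ with union $V(G)$; it is $w$-colourable if $\chi(G[W_i])\le w$ for $1\le i\le n$. With respect to a grading, $u$ is earlier than $v$ if $u\in W_i$ and $v\in W_j$ with $i<j$. -}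

module Defs where

open import Data.Nat using (ℕ; _<_)
open import Data.Fin using (Fin; toℕ)
open import Data.Fin.Subset using (Subset; _∈_; ⊤)
open import Data.Product using (Σ; ∃; _×_; _,_)
open import Relation.Nullary using (¬_; Dec)
open import Relation.Binary.PropositionalEquality using (_≡_; _≢_)

record Graph (N : ℕ) : Set₁ where
  field
    Adj     : Fin N → Fin N → Set
    adj?    : ∀ u v → Dec (Adj u v)
    sym     : ∀ {u v} → Adj u v → Adj v u
    irrefl  : ∀ {u} → ¬ Adj u u
open Graph public

module _ {N : ℕ} (G : Graph N) where

  Colourable : Subset N → ℕ → Set
  Colourable X k = Σ (Fin N → Fin k) λ f →
    ∀ u v → u ∈ X → v ∈ X → Adj G u v → f u ≢ f v

  χ≤ : Subset N → ℕ → Set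
  χ≤ X k = Colourable X k

  χ> : Subset N → ℕ → Set
  χ> X k = ¬ Colourable X k

  data WalkIn (X : Subset N) : Fin N → Fin N → Set where
    here : ∀ {u} → u ∈ X → WalkIn X u u
    step : ∀ {u v w} → u ∈ X → Adj G u v → WalkIn X v w → WalkIn X u w

  Connected : Subset N → Set
  Connected X = (∃ λ v → v ∈ X) × (∀ u v → u ∈ X → v ∈ X → WalkIn X u v)

-- A grading (W_1,…,W_n) of the vertex set: pairwise disjoint sets with union V(G),
-- represented by the index map  part : Fin N → Fin n  (v ∈ W_{part v}).
Grading : ℕ → ℕ → Set
Grading N n = Fin N → Fin n

Part : ∀ {N n} → Grading N n → Fin n → Fin N → Set
Part g i v = g v ≡ i

module _ {N : ℕ} (G : Graph N) where
  WColourable : ∀ {n} → Grading N n → ℕ → Set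
  WColourable {n} g w = ∀ (i : Fin n) →
    Σ (Fin N → Fin w) λ f → ∀ u v → g u ≡ i → g v ≡ i → Adj G u v → f u ≢ f v

Earlier : ∀ {N n} → Grading N n → Fin N → Fin N → Set
Earlier g u v = toℕ (g u) < toℕ (g v)

module Submission where

-- Call an edge uv with u earlier than v good if the component of u among the vertices no later
-- than u and the component of v among the vertices later than u both have χ > c; these are then
-- the sets Y and X. If no edge is good, colour with c colours the vertices whose lower component
-- is c-colourable, with c more those having some c-colourable upper component, and every other
-- vertex with its colour in its part: two adjacent vertices of the last kind on different levels
-- would form a good edge.

open import Defs
open import Data.Empty using (⊥-elim)
open import Data.Fin using (Fin; zero; suc; toℕ; join; splitAt)
open import Data.Fin.Properties using (any?; all?; splitAt-join; toℕ-injective)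
import Data.Fin.Properties as Fin
open import Data.Fin.Subset using (Subset; _∈_; _⊆_; _-_; _∪_; ∁; ⊤; ∣_∣)
open import Data.Fin.Subset.Properties using (_∈?_; ∈⊤; x∈p∪q⁻; p⊆p∪q; q⊆p∪q; x∈∁p⇒x∉p; p∪∁p≡⊤; x∈p∧x≢y⇒x∈p-y; p─q⊆p; x∈p⇒∣p-x∣<∣p∣)
open import Data.Nat using (ℕ; zero; suc; _+_; _*_; _≤_; _<_; _≤?_; _<?_)
open import Data.Nat.Properties using (+-comm; +-identityʳ; ≤-refl; ≤-trans; ≤-total; <-cmp; <-≤-trans; ≤-<-trans; ≤-pred; n<1+n)
open import Data.Product using (Σ; ∃; _×_; _,_; proj₁; proj₂)
open import Data.Sum using (_⊎_; inj₁; inj₂; [_,_])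
open import Data.Sum.Properties using (inj₁-injective; inj₂-injective)
open import Data.Vec using (tabulate)
open import Data.Vec.Properties using (lookup∘tabulate; lookup⇒[]=; []=⇒lookup; tabulate-cong)
import Data.Vec.Functional as Vector
open import Function using (_∘_; id; _⇔_; mk⇔)
open import Level using (Level)
open import Relation.Binary.Definitions using (Reflexive; Transitive; Total; tri<; tri≈; tri>)
open import Relation.Binary.PropositionalEquality using (_≡_; _≢_; refl; trans; cong; subst; _≗_)
import Relation.Binary.PropositionalEquality as ≡
open import Relation.Nullary using (¬_; Dec; yes; no; does)
open import Relation.Nullary.Decidable using (dec-true; does-⇔; _×-dec_; _→-dec_; ¬?)
open import Relation.Unary using (Pred; Decidable)

private
  variable
    ℓ : Level
    m N : ℕ

greatest : {_≼_ : Fin m → Fin m → Set} → Reflexive _≼_ → Transitive _≼_ → Total _≼_ →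
           {P : Pred (Fin m) ℓ} → Decidable P → ∃ P → ∃ λ i → P i × (∀ j → P j → j ≼ i)
greatest {m = zero} _ _ _ _ (() , _)
greatest {m = suc m} {_≼_} ≼-refl ≼-trans ≼-total {P} P? (x , px) with any? (P? ∘ suc)
... | no none = zero , P-zero x px , λ { zero _ → ≼-refl ; (suc j) pj → ⊥-elim (none (j , pj)) }
  where
  P-zero : ∀ x → P x → P zero
  P-zero zero    px = px
  P-zero (suc x) px = ⊥-elim (none (x , px))
... | yes some with greatest ≼-refl ≼-trans (λ i j → ≼-total (suc i) (suc j)) (P? ∘ suc) some
...   | i , pi , i-max with P? zero | ≼-total zero (suc i)
...     | no ¬p0 | _        = suc i , pi , λ { zero p0 → ⊥-elim (¬p0 p0) ; (suc j) pj → i-max j pj }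
...     | yes _  | inj₁ 0≼i = suc i , pi , λ { zero _ → 0≼i ; (suc j) pj → i-max j pj }
...     | yes p0 | inj₂ i≼0 = zero , p0 , λ { zero _ → ≼-refl ; (suc j) pj → ≼-trans (i-max j pj) i≼0 }

∃-function? : ∀ m {k} {P : (Fin m → Fin k) → Set ℓ} →
              (∀ {f f′} → f ≗ f′ → P f → P f′) → Decidable P → Dec (∃ P)
∃-function? zero resp P? with P? (λ ())
... | yes p = yes (_ , p)
... | no ¬p = no λ (f , pf) → ¬p (resp (λ ()) pf)
∃-function? (suc m) resp P?
  with any? (λ a → ∃-function? m (λ eq → resp λ { zero → refl ; (suc i) → eq i }) (P? ∘ (a Vector.∷_)))
... | yes (a , f , p) = yes (a Vector.∷ f , p)
... | no none = no λ (f , pf) → none (Vector.head f , Vector.tail f , resp (λ { zero → refl ; (suc i) → refl }) pf)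

subset : {P : Pred (Fin N) ℓ} → Decidable P → Subset N
subset P? = tabulate (does ∘ P?)

module _ {P : Pred (Fin N) ℓ} (P? : Decidable P) where

  ∈-subset⁺ : ∀ {x} → P x → x ∈ subset P?
  ∈-subset⁺ {x} px = lookup⇒[]= x _ (trans (lookup∘tabulate _ x) (dec-true (P? x) px))

  ∈-subset⁻ : ∀ {x} → x ∈ subset P? → P x
  ∈-subset⁻ {x} x∈ with P? x | trans (≡.sym (lookup∘tabulate (does ∘ P?) x)) ([]=⇒lookup x∈)
  ... | yes px | _ = px
  ... | no _   | ()

subset-cong : {P Q : Pred (Fin N) ℓ} (P? : Decidable P) (Q? : Decidable Q) →
              (∀ x → P x ⇔ Q x) → subset P? ≡ subset Q?
subset-cong P? Q? P⇔Q = tabulate-cong λ x → does-⇔ (P⇔Q x) (P? x) (Q? x)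

module _ {N : ℕ} (G : Graph N) where

  walk-source∈ : ∀ {Z u v} → WalkIn G Z u v → u ∈ Z
  walk-source∈ (here u∈) = u∈
  walk-source∈ (step u∈ _ _) = u∈

  walk-target∈ : ∀ {Z u v} → WalkIn G Z u v → v ∈ Z
  walk-target∈ (here v∈) = v∈
  walk-target∈ (step _ _ p) = walk-target∈ p

  walk-mono : ∀ {Z Z′ u v} → Z ⊆ Z′ → WalkIn G Z u v → WalkIn G Z′ u v
  walk-mono Z⊆Z′ (here u∈) = here (Z⊆Z′ u∈)
  walk-mono Z⊆Z′ (step u∈ a p) = step (Z⊆Z′ u∈) a (walk-mono Z⊆Z′ p)

  walk-++ : ∀ {Z u v x} → WalkIn G Z u v → WalkIn G Z v x → WalkIn G Z u x
  walk-++ (here _) q = q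
  walk-++ (step u∈ a p) q = step u∈ a (walk-++ p q)

  walk-reverse : ∀ {Z u v} → WalkIn G Z u v → WalkIn G Z v u
  walk-reverse (here u∈) = here u∈
  walk-reverse (step u∈ a p) = walk-++ (walk-reverse p) (step (walk-source∈ p) (sym G a) (here u∈))

  -- Either the walk avoids u, or its part after the last visit to u does.
  walk-avoiding : ∀ {Z x v} u → u ≢ v → WalkIn G Z x v →
                  WalkIn G (Z - u) x v ⊎ ∃ λ y → Adj G u y × WalkIn G (Z - u) y v
  walk-avoiding {x = x} u u≢v (here x∈) with x Fin.≟ u
  ... | yes refl = ⊥-elim (u≢v refl)
  ... | no x≢u   = inj₁ (here (x∈p∧x≢y⇒x∈p-y x∈ x≢u))
  walk-avoiding {x = x} u u≢v (step {v = x′} x∈ a p) with walk-avoiding u u≢v p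
  ... | inj₂ tail = inj₂ tail
  ... | inj₁ p′ with x Fin.≟ u
  ...   | yes refl = inj₂ (x′ , a , p′)
  ...   | no x≢u   = inj₁ (step (x∈p∧x≢y⇒x∈p-y x∈ x≢u) a p′)

  -- Each step deletes u from Z, so the fuel k > ∣ Z ∣ never runs out.
  walk?-fuel : ∀ k Z → ∣ Z ∣ < k → ∀ u v → Dec (WalkIn G Z u v)
  walk?-fuel (suc k) Z ∣Z∣<k u v with u ∈? Z
  ... | no u∉Z = no (u∉Z ∘ walk-source∈)
  ... | yes u∈Z with u Fin.≟ v
  ...   | yes refl = yes (here u∈Z)
  ...   | no u≢v with any? (λ y → adj? G u y ×-dec walk?-fuel k (Z - u) ∣Z-u∣<k y v)
    where
    ∣Z-u∣<k : ∣ Z - u ∣ < k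
    ∣Z-u∣<k = <-≤-trans (x∈p⇒∣p-x∣<∣p∣ u∈Z) (≤-pred ∣Z∣<k)
  ...     | yes (y , a , p) = yes (step u∈Z a (walk-mono (p─q⊆p Z _) p))
  ...     | no none = no λ where
    (here _) → u≢v refl
    (step _ a p) → none ([ (λ p′ → _ , a , p′) , id ] (walk-avoiding u u≢v p))

  walk? : ∀ Z u v → Dec (WalkIn G Z u v)
  walk? Z = walk?-fuel (suc ∣ Z ∣) Z (n<1+n _)

  component : Subset N → Fin N → Subset N
  component Z v = subset (walk? Z v)

  component⊆ : ∀ {Z v} → component Z v ⊆ Z
  component⊆ {Z} {v} x∈ = walk-target∈ (∈-subset⁻ (walk? Z v) x∈)

  ∈component : ∀ {Z v} → v ∈ Z → v ∈ component Z v
  ∈component {Z} {v} v∈ = ∈-subset⁺ (walk? Z v) (here v∈)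

  walk-within-component : ∀ {Z v a b} → WalkIn G Z v a → WalkIn G Z a b → WalkIn G (component Z v) a b
  walk-within-component {Z} {v} p (here _) = here (∈-subset⁺ (walk? Z v) p)
  walk-within-component {Z} {v} p (step a∈ e q) =
    step (∈-subset⁺ (walk? Z v) p) e (walk-within-component (walk-++ p (step a∈ e (here (walk-source∈ q)))) q)

  component-connected : ∀ {Z v} → v ∈ Z → Connected G (component Z v)
  component-connected {Z} {v} v∈ = (v , ∈component v∈) , λ x y x∈ y∈ →
    let v⇝x = ∈-subset⁻ (walk? Z v) x∈
        v⇝y = ∈-subset⁻ (walk? Z v) y∈
    in walk-within-component v⇝x (walk-++ (walk-reverse v⇝x) v⇝y)

  connected⊆component : ∀ {K Z y} → Connected G K → y ∈ K → K ⊆ Z → K ⊆ component Z y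
  connected⊆component {y = y} (_ , K-walks) y∈ K⊆Z x∈ =
    ∈-subset⁺ (walk? _ y) (walk-mono K⊆Z (K-walks y _ y∈ x∈))

  component-≡ : ∀ {Z x y} → y ∈ component Z x → component Z y ≡ component Z x
  component-≡ {Z} {x} {y} y∈ = subset-cong (walk? Z y) (walk? Z x) λ z →
    mk⇔ (walk-++ x⇝y) (walk-++ (walk-reverse x⇝y))
    where
    x⇝y : WalkIn G Z x y
    x⇝y = ∈-subset⁻ (walk? Z x) y∈

  colourable? : ∀ S k → Dec (Colourable G S k)
  colourable? S k = ∃-function? N
    (λ f≗f′ f-proper u v u∈ v∈ a eq → f-proper u v u∈ v∈ a (trans (f≗f′ u) (trans eq (≡.sym (f≗f′ v)))))
    (λ f → all? λ u → all? λ v → u ∈? S →-dec v ∈? S →-dec adj? G u v →-dec ¬? (f u Fin.≟ f v))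

  colourable-⊆ : ∀ {S S′ k} → S ⊆ S′ → Colourable G S′ k → Colourable G S k
  colourable-⊆ S⊆S′ (f , f-proper) = f , λ u v u∈ v∈ → f-proper u v (S⊆S′ u∈) (S⊆S′ v∈)

  -- The colouring found by colourable?; unlike the witness passed in, it depends on S only.
  canonical : ∀ {S k} → Colourable G S k → Colourable G S k
  canonical {S} {k} col with colourable? S k
  ... | yes col′ = col′
  ... | no ¬col  = ⊥-elim (¬col col)

  canonical-≡ : ∀ {S S′ k} → S ≡ S′ → (col : Colourable G S k) (col′ : Colourable G S′ k) →
                proj₁ (canonical col) ≡ proj₁ (canonical col′)
  canonical-≡ {S} {k = k} refl col col′ with colourable? S k
  ... | yes _   = refl
  ... | no ¬col = ⊥-elim (¬col col)

  -- A proper colouring of G[Z] defined on Z only; unlike Colourable it exists for Z = ∅ and k = 0.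
  ColouringOn : Subset N → ℕ → Set
  ColouringOn Z k = Σ (∀ x → x ∈ Z → Fin k) λ f →
    ∀ {x y} (x∈ : x ∈ Z) (y∈ : y ∈ Z) → Adj G x y → f x x∈ ≢ f y y∈

  colouringOn-components : ∀ {Z k} → (∀ x → x ∈ Z → Colourable G (component Z x) k) → ColouringOn Z k
  colouringOn-components {Z} H = (λ x x∈ → proj₁ (canonical (H x x∈)) x) , proper
    where
    proper : ∀ {x y} (x∈ : x ∈ Z) (y∈ : y ∈ Z) → Adj G x y →
             proj₁ (canonical (H x x∈)) x ≢ proj₁ (canonical (H y y∈)) y
    proper {x} {y} x∈ y∈ a eq = proj₂ (canonical (H x x∈)) x y (∈component x∈) y∈Cx a
      (trans eq (cong (λ f → f y) (canonical-≡ (component-≡ {Z} {x} y∈Cx) (H y y∈) (H x x∈))))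
      where
      y∈Cx : y ∈ component Z x
      y∈Cx = ∈-subset⁺ (walk? Z x) (step x∈ a (here y∈))

  colouringOn-∪ : ∀ {S S′ a b} → ColouringOn S a → ColouringOn S′ b → ColouringOn (S ∪ S′) (a + b)
  colouringOn-∪ {S} {S′} {a} {b} (f , f-proper) (f′ , f′-proper) =
    (λ x x∈ → join a b (colour (x ∈? S) x∈)) , λ x∈ y∈ e → colour-proper (_ ∈? S) (_ ∈? S) x∈ y∈ e ∘ join-injective
    where
    colour : ∀ {x} → Dec (x ∈ S) → x ∈ S ∪ S′ → Fin a ⊎ Fin b
    colour (yes x∈S) _  = inj₁ (f _ x∈S)
    colour (no x∉S)  x∈ = inj₂ (f′ _ ([ (λ x∈S → ⊥-elim (x∉S x∈S)) , id ] (x∈p∪q⁻ S S′ x∈)))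
    colour-proper : ∀ {x y} (x∈S? : Dec (x ∈ S)) (y∈S? : Dec (y ∈ S)) x∈ y∈ → Adj G x y →
                    colour x∈S? x∈ ≢ colour y∈S? y∈
    colour-proper (yes x∈S) (yes y∈S) _ _ e eq = f-proper x∈S y∈S e (inj₁-injective eq)
    colour-proper (yes _)   (no _)    _ _ _ ()
    colour-proper (no _)    (yes _)   _ _ _ ()
    colour-proper (no _)    (no _)    _ _ e eq = f′-proper _ _ e (inj₂-injective eq)
    join-injective : ∀ {i j} → join a b i ≡ join a b j → i ≡ j
    join-injective {i} {j} eq = trans (≡.sym (splitAt-join a b i)) (trans (cong (splitAt a) eq) (splitAt-join a b j))

  colouringOn⇒colourable : ∀ {k} → ColouringOn ⊤ k → Colourable G ⊤ k
  colouringOn⇒colourable (f , f-proper) = (λ x → f x ∈⊤) , λ _ _ _ _ e → f-proper ∈⊤ ∈⊤ e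

module _ {N n : ℕ} (G : Graph N) (g : Grading N n) (c : ℕ) where

  level : Fin N → ℕ
  level x = toℕ (g x)

  Below Above : Fin n → Subset N
  Below i = subset (λ x → level x ≤? toℕ i)
  Above i = subset (λ x → toℕ i <? level x)

  ∈Below⁻ : ∀ {x i} → x ∈ Below i → level x ≤ toℕ i
  ∈Below⁻ {i = i} = ∈-subset⁻ (λ x → level x ≤? toℕ i)

  ∈Above⁻ : ∀ {x i} → x ∈ Above i → toℕ i < level x
  ∈Above⁻ {i = i} = ∈-subset⁻ (λ x → toℕ i <? level x)

  lowerComponent : Fin N → Subset N
  lowerComponent x = component G (Below (g x)) x

  upperComponent : Fin n → Fin N → Subset N
  upperComponent i y = component G (Above i) y

  GoodEdge : Fin N → Fin N → Set
  GoodEdge u v = Adj G u v × level u < level v ×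
                 χ> G (lowerComponent u) c × χ> G (upperComponent (g u) v) c

  goodEdge? : ∀ u v → Dec (GoodEdge u v)
  goodEdge? u v = adj? G u v ×-dec level u <? level v ×-dec
                  ¬? (colourable? G (lowerComponent u) c) ×-dec ¬? (colourable? G (upperComponent (g u) v) c)

  goodEdge⇒separated : ∀ {u v} → GoodEdge u v →
    Σ (Subset N) λ X → Σ (Subset N) λ Y →
      Connected G X × Connected G Y ×
      (∀ y x → y ∈ Y → x ∈ X → Earlier g y x) ×
      (∃ λ x → ∃ λ y → x ∈ X × y ∈ Y × Adj G x y) ×
      χ> G X c × χ> G Y c
  goodEdge⇒separated {u} {v} (e , u<v , χ>lower , χ>upper) =
    upperComponent (g u) v , lowerComponent u ,
    component-connected G v∈Above , component-connected G u∈Below ,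
    earlier ,
    (v , u , ∈component G v∈Above , ∈component G u∈Below , sym G e) ,
    χ>upper , χ>lower
    where
    earlier : ∀ y x → y ∈ lowerComponent u → x ∈ upperComponent (g u) v → Earlier g y x
    earlier _ _ y∈ x∈ = ≤-<-trans (∈Below⁻ (component⊆ G {v = u} y∈)) (∈Above⁻ (component⊆ G {v = v} x∈))
    u∈Below : u ∈ Below (g u)
    u∈Below = ∈-subset⁺ (λ x → level x ≤? level u) ≤-refl
    v∈Above : v ∈ Above (g u)
    v∈Above = ∈-subset⁺ (λ x → level u <? level x) u<v

  lowerSmall? : Decidable (λ x → χ≤ G (lowerComponent x) c)
  lowerSmall? x = colourable? G (lowerComponent x) c

  lowerSmall : Subset N
  lowerSmall = subset lowerSmall?

  UpperSmall : Fin N → Set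
  UpperSmall x = ∃ λ i → toℕ i < level x × χ≤ G (upperComponent i x) c

  upperSmall? : Decidable UpperSmall
  upperSmall? x = any? λ i → toℕ i <? level x ×-dec colourable? G (upperComponent i x) c

  upperSmall : Subset N
  upperSmall = subset upperSmall?

  -- A component K of lowerSmall lies in the lower component of its latest vertex.
  lowerSmall-component-colourable : ∀ {x} → x ∈ lowerSmall → χ≤ G (component G lowerSmall x) c
  lowerSmall-component-colourable {x} x∈
    with greatest {_≼_ = λ a b → level a ≤ level b} ≤-refl ≤-trans (λ a b → ≤-total (level a) (level b))
                  (_∈? component G lowerSmall x) (x , ∈component G x∈)
  ... | v , v∈K , v-latest =
    colourable-⊆ G K⊆lower (∈-subset⁻ lowerSmall? (component⊆ G {v = x} v∈K))
    where
    K⊆Below : component G lowerSmall x ⊆ Below (g v)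
    K⊆Below z∈K = ∈-subset⁺ (λ z → level z ≤? level v) (v-latest _ z∈K)
    K⊆lower : component G lowerSmall x ⊆ lowerComponent v
    K⊆lower = connected⊆component G (component-connected G x∈) v∈K K⊆Below

  -- A component K of upperSmall lies in the upper component, above W_i, of any of its vertices,
  -- where i is the least index witnessing UpperSmall for a vertex of K.
  upperSmall-component-colourable : ∀ {x} → x ∈ upperSmall → χ≤ G (component G upperSmall x) c
  upperSmall-component-colourable {x} x∈ with ∈-subset⁻ upperSmall? x∈
  ... | j , j<x , χ≤upper
    with greatest {_≼_ = λ a b → toℕ b ≤ toℕ a} ≤-refl (λ p q → ≤-trans q p) (λ a b → ≤-total (toℕ b) (toℕ a))
                  Witness? (j , x , ∈component G x∈ , j<x , χ≤upper)
    where
    Witness : Fin n → Set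
    Witness i = ∃ λ y → y ∈ component G upperSmall x × toℕ i < level y × χ≤ G (upperComponent i y) c
    Witness? : Decidable Witness
    Witness? i = any? λ y → y ∈? component G upperSmall x ×-dec toℕ i <? level y ×-dec colourable? G (upperComponent i y) c
  ... | i , (y , y∈K , _ , χ≤upper′) , i-least = colourable-⊆ G K⊆upper χ≤upper′
    where
    K⊆Above : component G upperSmall x ⊆ Above i
    K⊆Above {z} z∈K with ∈-subset⁻ upperSmall? (component⊆ G {v = x} z∈K)
    ... | k , k<z , χ≤upperₖ = ∈-subset⁺ (λ z → toℕ i <? level z) (≤-<-trans (i-least k (z , z∈K , k<z , χ≤upperₖ)) k<z)
    K⊆upper : component G upperSmall x ⊆ upperComponent i y
    K⊆upper = connected⊆component G (component-connected G x∈) y∈K K⊆Above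

  rest : Subset N
  rest = ∁ (lowerSmall ∪ upperSmall)

  rest⇒χ>lower : ∀ {x} → x ∈ rest → χ> G (lowerComponent x) c
  rest⇒χ>lower x∈ = x∈∁p⇒x∉p x∈ ∘ p⊆p∪q upperSmall ∘ ∈-subset⁺ lowerSmall?

  rest⇒χ>upper : ∀ {y i} → y ∈ rest → toℕ i < level y → χ> G (upperComponent i y) c
  rest⇒χ>upper {i = i} y∈ i<y = x∈∁p⇒x∉p y∈ ∘ q⊆p∪q lowerSmall upperSmall ∘ ∈-subset⁺ upperSmall? ∘ (i ,_) ∘ (i<y ,_)

  module _ {w : ℕ} (wc : WColourable G g w) (no-goodEdge : ∀ u v → ¬ GoodEdge u v) where

    partColour : Fin N → Fin w
    partColour x = proj₁ (wc (g x)) x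

    partColour-proper : ∀ {x y} → g x ≡ g y → Adj G x y → partColour x ≢ partColour y
    partColour-proper {x} {y} gx≡gy e with g y in gy≡j | gx≡gy
    ... | _ | refl = proj₂ (wc (g x)) x y refl gy≡j e

    rest-colouring : ColouringOn G rest w
    rest-colouring = (λ x _ → partColour x) , proper
      where
      proper : ∀ {x y} → x ∈ rest → y ∈ rest → Adj G x y → partColour x ≢ partColour y
      proper {x} {y} x∈ y∈ e with <-cmp (level x) (level y)
      ... | tri< x<y _ _ = ⊥-elim (no-goodEdge x y (e , x<y , rest⇒χ>lower x∈ , rest⇒χ>upper y∈ x<y))
      ... | tri> _ _ y<x = ⊥-elim (no-goodEdge y x (sym G e , y<x , rest⇒χ>lower y∈ , rest⇒χ>upper x∈ y<x))
      ... | tri≈ _ x≈y _ = partColour-proper (toℕ-injective x≈y) e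

    no-goodEdge⇒colourable : χ≤ G ⊤ (w + 2 * c)
    no-goodEdge⇒colourable = subst (χ≤ G ⊤) colours-≡ (colouringOn⇒colourable G colouring)
      where
      colouring : ColouringOn G ⊤ ((c + c) + w)
      colouring = subst (λ S → ColouringOn G S ((c + c) + w)) (p∪∁p≡⊤ (lowerSmall ∪ upperSmall))
        (colouringOn-∪ G (colouringOn-∪ G (colouringOn-components G λ _ → lowerSmall-component-colourable)
                                          (colouringOn-components G λ _ → upperSmall-component-colourable))
                         rest-colouring)
      colours-≡ : (c + c) + w ≡ w + 2 * c
      colours-≡ = trans (+-comm (c + c) w) (cong (λ k → w + (c + k)) (≡.sym (+-identityʳ c)))

mainTheorem2 : (w c N n : ℕ) (G : Graph N) (g : Grading N n) →
    WColourable G g w →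
    χ> G ⊤ (w + 2 * c) →
    Σ (Subset N) λ X → Σ (Subset N) λ Y →
      Connected G X × Connected G Y ×
      (∀ y x → y ∈ Y → x ∈ X → Earlier g y x) ×
      (∃ λ x → ∃ λ y → x ∈ X × y ∈ Y × Adj G x y) ×
      χ> G X c × χ> G Y c
mainTheorem2 w c N n G g wc χ>w+2c with any? (λ u → any? (goodEdge? G g c u))
... | yes (u , v , good) = goodEdge⇒separated G g c good
... | no none = ⊥-elim (χ>w+2c (no-goodEdge⇒colourable G g c wc λ u v good → none (u , v , good)))
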